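{- Let $G$ be a finite, simple, connected graph with $res(G)=3$, and let $v\in V(G)$ be a vertex with $\deg(v)=5$. Then the subgraph of $G$ induced by the neighborhood $N(v)$ is a cycle $C_5$.
   Context: $d$ denotes graph distance; $N(v)$ is the set of neighbors of $v$. For an ordered set $W=\{w_1,\dots,w_k\}\subseteq V(G)$ and $v\in V(G)$, $r(v|W)=(d(v,w_1),\dots,d(v,w_k))$. $W$ is a resolving set if distinct vertices of $G$ have distinct representations with respect to $W$. The resolving number $res(G)$ is the minimum $k$ such that every $k$-subset of $V(G)$ is a resolving set of $G$. -}

module Defs where

open import Data.Nat using (ℕ; zero; suc; _≤_; _<_; _%_; _≡ᵇ_)
open import Data.Fin using (Fin; toℕ)
open import Data.Fin.Subset using (Subset; _∈_; ∣_∣)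
open import Data.Vec using (tabulate)
open import Data.Bool using (Bool; true; false; _∨_)
open import Data.Product using (Σ; ∃; _×_; _,_)
open import Relation.Binary.PropositionalEquality using (_≡_; _≢_)
open import Function.Definitions using (Injective)

record Graph : Set where
  field
    n     : ℕ
    adj   : Fin n → Fin n → Bool
    sym   : ∀ u v → adj u v ≡ adj v u
    irref : ∀ v → adj v v ≡ false

module _ (G : Graph) where
  open Graph G

  data Walk : Fin n → Fin n → ℕ → Set where
    here : ∀ {u} → Walk u u zero
    step : ∀ {u w v k} → adj u w ≡ true → Walk w v k → Walk u v (suc k)

  Connected : Set
  Connected = ∀ u v → ∃ λ k → Walk u v k

  Dist : Fin n → Fin n → ℕ → Set
  Dist u v k = Walk u v k × (∀ m → Walk u v m → k ≤ m)

  Resolving : Subset n → Set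
  Resolving W = ∀ x y → x ≢ y →
    Σ (Fin n) λ w → w ∈ W × ∃ λ k → ∃ λ k' → Dist x w k × Dist y w k' × k ≢ k'

  AllResolving : ℕ → Set
  AllResolving k = ∀ (W : Subset n) → ∣ W ∣ ≡ k → Resolving W

  ResNumber : ℕ → Set
  ResNumber r = AllResolving r × (∀ k → k < r → AllResolving k → Data.Empty.⊥)
    where import Data.Empty

  N : Fin n → Subset n
  N v = tabulate (λ u → adj v u)

  degree : Fin n → ℕ
  degree v = ∣ N v ∣

c5adj : Fin 5 → Fin 5 → Bool
c5adj i j = (toℕ j ≡ᵇ (suc (toℕ i) % 5)) ∨ (toℕ i ≡ᵇ (suc (toℕ j) % 5))

module _ (G : Graph) where
  open Graph G

  InducedIsC5 : Subset n → Set
  InducedIsC5 S = Σ (Fin 5 → Fin n) λ f →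
      Injective _≡_ _≡_ f
    × (∀ i → f i ∈ S)
    × (∀ u → u ∈ S → ∃ λ i → f i ≡ u)
    × (∀ i j → adj (f i) (f j) ≡ c5adj i j)

module Submission where

-- Let x ≠ y be neighbours of v and a, b two further neighbours.
-- The 3-set W = {v, a, b} resolves x and y.  Both are at distance 1 from
-- v, and for a neighbour a of v the distance d(x, a) is 1 or 2 according
-- as x ~ a or not (v is a common neighbour).  Hence x and y must differ in
-- their adjacency to a or to b: among the other three neighbours, at most
-- one fails to separate x from y.  Call a graph on five vertices with this
-- property "separating".

open import Defs
open import Data.Fin using (Fin)
open import Relation.Binary.PropositionalEquality using (_≡_)

open import Data.Bool using (Bool; true; false; if_then_else_)
open import Data.Bool.Properties using () renaming (_≟_ to _≟ᵇ_)
open import Data.Empty using (⊥-elim)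
open import Data.Fin using (zero; suc; _≟_)
open import Data.Fin.Patterns using (0F; 1F; 2F; 3F; 4F)
open import Data.Fin.Properties using (all?; any?; suc-injective)
open import Data.Fin.Subset using (Subset; inside; outside; _∈_; _∉_; ⁅_⁆; ∣_∣)
open import Data.Fin.Subset.Properties using (∣⁅x⁆∣≡1; x∈⁅y⁆⇒x≡y)
open import Data.List using (List; []; _∷_)
open import Data.List.Relation.Unary.Any using (Any; satisfied) renaming (any? to anyᴸ?)
open import Data.Nat using (ℕ; zero; suc; _≤_; s≤s; z≤n)
open import Data.Nat.Properties using (≤-antisym)
open import Data.Product using (∃; _×_; _,_; proj₂)
open import Data.Sum using (_⊎_; inj₁; inj₂)
open import Data.Vec using (Vec; []; _∷_; lookup; here; there)
open import Data.Vec.Properties using (lookup∘tabulate; []=⇒lookup)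
open import Function.Definitions using (Injective)
open import Relation.Binary.PropositionalEquality using (_≢_; ≢-sym; refl; sym; trans; cong; subst)
open import Relation.Nullary using (Dec; ¬_; ¬?)
open import Relation.Nullary.Decidable using (_×-dec_; _→-dec_; from-yes; map′)

Graph₅ : Set
Graph₅ = Fin 5 → Fin 5 → Bool

Separating : Graph₅ → Set
Separating H = ∀ i j k l → i ≢ j → k ≢ l → k ≢ i → k ≢ j → l ≢ i → l ≢ j →
  H i k ≡ H j k → H i l ≢ H j l

-- Separating and C5Labelling are decidable, so that the classification
-- below can be checked by evaluation.
separating? : ∀ H → Dec (Separating H)
separating? H =
  all? λ i → all? λ j → all? λ k → all? λ l →
    ¬? (i ≟ j) →-dec ¬? (k ≟ l) →-dec ¬? (k ≟ i) →-dec ¬? (k ≟ j) →-dec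
    ¬? (l ≟ i) →-dec ¬? (l ≟ j) →-dec (H i k ≟ᵇ H j k) →-dec ¬? (H i l ≟ᵇ H j l)

C5Labelling : Graph₅ → (Fin 5 → Fin 5) → Set
C5Labelling H σ =
  Injective _≡_ _≡_ σ × (∀ u → ∃ λ a → σ a ≡ u) × (∀ a c → H (σ a) (σ c) ≡ c5adj a c)

c5Labelling? : ∀ H σ → Dec (C5Labelling H σ)
c5Labelling? H σ = injective? ×-dec surjective? ×-dec isomorphic?
  where
  injective? : Dec (Injective _≡_ _≡_ σ)
  injective? = map′ (λ inj {a} {c} → inj a c) (λ inj a c → inj)
                    (all? λ a → all? λ c → (σ a ≟ σ c) →-dec (a ≟ c))
  surjective? : Dec (∀ u → ∃ λ a → σ a ≡ u)
  surjective? = all? λ u → any? λ a → σ a ≟ u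
  isomorphic? : Dec (∀ a c → H (σ a) (σ c) ≡ c5adj a c)
  isomorphic? = all? λ a → all? λ c → H (σ a) (σ c) ≟ᵇ c5adj a c

-- The Hamiltonian cycles of K5, each written once as a sequence starting at
-- vertex 0 (up to reversal): the candidate labellings.
hamiltonianCycles : List (Vec (Fin 5) 5)
hamiltonianCycles =
  (0F ∷ 1F ∷ 2F ∷ 3F ∷ 4F ∷ []) ∷ (0F ∷ 1F ∷ 2F ∷ 4F ∷ 3F ∷ []) ∷ (0F ∷ 1F ∷ 3F ∷ 2F ∷ 4F ∷ []) ∷
  (0F ∷ 1F ∷ 3F ∷ 4F ∷ 2F ∷ []) ∷ (0F ∷ 1F ∷ 4F ∷ 2F ∷ 3F ∷ []) ∷ (0F ∷ 1F ∷ 4F ∷ 3F ∷ 2F ∷ []) ∷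
  (0F ∷ 2F ∷ 1F ∷ 3F ∷ 4F ∷ []) ∷ (0F ∷ 2F ∷ 1F ∷ 4F ∷ 3F ∷ []) ∷ (0F ∷ 2F ∷ 3F ∷ 1F ∷ 4F ∷ []) ∷
  (0F ∷ 2F ∷ 4F ∷ 1F ∷ 3F ∷ []) ∷ (0F ∷ 3F ∷ 1F ∷ 2F ∷ 4F ∷ []) ∷ (0F ∷ 3F ∷ 2F ∷ 1F ∷ 4F ∷ []) ∷ []

graphOf : Vec Bool 10 → Graph₅
graphOf (b01 ∷ b02 ∷ b03 ∷ b04 ∷ b12 ∷ b13 ∷ b14 ∷ b23 ∷ b24 ∷ b34 ∷ []) i j =
  lookup (lookup matrix i) j
  where
  matrix : Vec (Vec Bool 5) 5
  matrix = (false ∷ b01   ∷ b02   ∷ b03   ∷ b04   ∷ []) ∷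
           (b01   ∷ false ∷ b12   ∷ b13   ∷ b14   ∷ []) ∷
           (b02   ∷ b12   ∷ false ∷ b23   ∷ b24   ∷ []) ∷
           (b03   ∷ b13   ∷ b23   ∷ false ∷ b34   ∷ []) ∷
           (b04   ∷ b14   ∷ b24   ∷ b34   ∷ false ∷ []) ∷ []

edgeBits : Graph₅ → Vec Bool 10
edgeBits H = H 0F 1F ∷ H 0F 2F ∷ H 0F 3F ∷ H 0F 4F ∷ H 1F 2F ∷
             H 1F 3F ∷ H 1F 4F ∷ H 2F 3F ∷ H 2F 4F ∷ H 3F 4F ∷ []

graphOf-edgeBits : (H : Graph₅) → (∀ i j → H i j ≡ H j i) → (∀ i → H i i ≡ false) →
  ∀ i j → graphOf (edgeBits H) i j ≡ H i j
graphOf-edgeBits H H-sym H-irr 0F 0F = sym (H-irr 0F)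
graphOf-edgeBits H H-sym H-irr 0F 1F = refl
graphOf-edgeBits H H-sym H-irr 0F 2F = refl
graphOf-edgeBits H H-sym H-irr 0F 3F = refl
graphOf-edgeBits H H-sym H-irr 0F 4F = refl
graphOf-edgeBits H H-sym H-irr 1F 0F = H-sym 0F 1F
graphOf-edgeBits H H-sym H-irr 1F 1F = sym (H-irr 1F)
graphOf-edgeBits H H-sym H-irr 1F 2F = refl
graphOf-edgeBits H H-sym H-irr 1F 3F = refl
graphOf-edgeBits H H-sym H-irr 1F 4F = refl
graphOf-edgeBits H H-sym H-irr 2F 0F = H-sym 0F 2F
graphOf-edgeBits H H-sym H-irr 2F 1F = H-sym 1F 2F
graphOf-edgeBits H H-sym H-irr 2F 2F = sym (H-irr 2F)
graphOf-edgeBits H H-sym H-irr 2F 3F = refl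
graphOf-edgeBits H H-sym H-irr 2F 4F = refl
graphOf-edgeBits H H-sym H-irr 3F 0F = H-sym 0F 3F
graphOf-edgeBits H H-sym H-irr 3F 1F = H-sym 1F 3F
graphOf-edgeBits H H-sym H-irr 3F 2F = H-sym 2F 3F
graphOf-edgeBits H H-sym H-irr 3F 3F = sym (H-irr 3F)
graphOf-edgeBits H H-sym H-irr 3F 4F = refl
graphOf-edgeBits H H-sym H-irr 4F 0F = H-sym 0F 4F
graphOf-edgeBits H H-sym H-irr 4F 1F = H-sym 1F 4F
graphOf-edgeBits H H-sym H-irr 4F 2F = H-sym 2F 4F
graphOf-edgeBits H H-sym H-irr 4F 3F = H-sym 3F 4F
graphOf-edgeBits H H-sym H-irr 4F 4F = sym (H-irr 4F)

allBits? : ∀ {n} {P : Vec Bool n → Set} → (∀ b → Dec (P b)) → Dec (∀ b → P b)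
allBits? {zero} P? = map′ (λ p → λ { [] → p }) (λ p → p []) (P? [])
allBits? {suc n} P? =
  map′ (λ { (p₁ , p₀) (true ∷ b) → p₁ b ; (p₁ , p₀) (false ∷ b) → p₀ b })
       (λ p → (λ b → p (true ∷ b)) , (λ b → p (false ∷ b)))
       (allBits? (λ b → P? (true ∷ b)) ×-dec allBits? (λ b → P? (false ∷ b)))

-- The exhaustive check: each of the 2¹⁰ graphs on five labelled vertices
-- that is separating has a Hamiltonian cycle labelling it as C5.
separating⇒cycle-bits : ∀ b → Separating (graphOf b) →
  Any (λ c → C5Labelling (graphOf b) (lookup c)) hamiltonianCycles
separating⇒cycle-bits = from-yes (allBits? λ b →
  separating? (graphOf b) →-dec anyᴸ? (λ c → c5Labelling? (graphOf b) (lookup c)) hamiltonianCycles)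

separating-cong : {H H′ : Graph₅} → (∀ i j → H i j ≡ H′ i j) → Separating H → Separating H′
separating-cong H≡H′ sep i j k l i≢j k≢l k≢i k≢j l≢i l≢j eqₖ eqₗ =
  sep i j k l i≢j k≢l k≢i k≢j l≢i l≢j
    (trans (H≡H′ i k) (trans eqₖ (sym (H≡H′ j k))))
    (trans (H≡H′ i l) (trans eqₗ (sym (H≡H′ j l))))

labelling-cong : {H H′ : Graph₅} {σ : Fin 5 → Fin 5} → (∀ i j → H i j ≡ H′ i j) →
  C5Labelling H σ → C5Labelling H′ σ
labelling-cong {σ = σ} H≡H′ (σ-inj , σ-surj , σ-iso) =
  σ-inj , σ-surj , λ a c → trans (sym (H≡H′ (σ a) (σ c))) (σ-iso a c)

separating⇒C5 : (H : Graph₅) → (∀ i j → H i j ≡ H j i) → (∀ i → H i i ≡ false) →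
  Separating H → ∃ λ σ → C5Labelling H σ
separating⇒C5 H H-sym H-irr sep =
  let (cycle , labelling) = satisfied (separating⇒cycle-bits (edgeBits H)
                                        (separating-cong (λ i j → sym (bits i j)) sep))
  in lookup cycle , labelling-cong bits labelling
  where
  bits : ∀ i j → graphOf (edgeBits H) i j ≡ H i j
  bits = graphOf-edgeBits H H-sym H-irr

insert : ∀ {n} → Fin n → Subset n → Subset n
insert zero    (_ ∷ p) = inside ∷ p
insert (suc x) (b ∷ p) = b ∷ insert x p

∈-insert⁻ : ∀ {n} (x : Fin n) (p : Subset n) {u} → u ∈ insert x p → u ≡ x ⊎ u ∈ p
∈-insert⁻ zero    (b ∷ p) {zero}  here      = inj₁ refl
∈-insert⁻ zero    (b ∷ p) {suc u} (there h) = inj₂ (there h)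
∈-insert⁻ (suc x) (b ∷ p) {zero}  here      = inj₂ here
∈-insert⁻ (suc x) (b ∷ p) {suc u} (there h) with ∈-insert⁻ x p h
... | inj₁ u≡x = inj₁ (cong suc u≡x)
... | inj₂ u∈p = inj₂ (there u∈p)

∣insert∣ : ∀ {n} (x : Fin n) (p : Subset n) → x ∉ p → ∣ insert x p ∣ ≡ suc ∣ p ∣
∣insert∣ zero    (outside ∷ p) x∉p = refl
∣insert∣ zero    (inside ∷ p)  x∉p = ⊥-elim (x∉p here)
∣insert∣ (suc x) (outside ∷ p) x∉p = ∣insert∣ x p (λ h → x∉p (there h))
∣insert∣ (suc x) (inside ∷ p)  x∉p = cong suc (∣insert∣ x p (λ h → x∉p (there h)))

triple : ∀ {n} → Fin n → Fin n → Fin n → Subset n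
triple a b c = insert a (insert b ⁅ c ⁆)

∈-triple⁻ : ∀ {n} {a b c u : Fin n} → u ∈ triple a b c → u ≡ a ⊎ u ≡ b ⊎ u ≡ c
∈-triple⁻ {a = a} {b} {c} h with ∈-insert⁻ a _ h
... | inj₁ u≡a = inj₁ u≡a
... | inj₂ h′ with ∈-insert⁻ b _ h′
...   | inj₁ u≡b = inj₂ (inj₁ u≡b)
...   | inj₂ u∈c = inj₂ (inj₂ (x∈⁅y⁆⇒x≡y c u∈c))

∣triple∣ : ∀ {n} {a b c : Fin n} → a ≢ b → a ≢ c → b ≢ c → ∣ triple a b c ∣ ≡ 3
∣triple∣ {a = a} {b} {c} a≢b a≢c b≢c =
  trans (∣insert∣ a _ a∉⁅b,c⁆)
        (cong suc (trans (∣insert∣ b _ (λ h → b≢c (x∈⁅y⁆⇒x≡y c h))) (cong suc (∣⁅x⁆∣≡1 c))))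
  where
  a∉⁅b,c⁆ : a ∉ insert b ⁅ c ⁆
  a∉⁅b,c⁆ h with ∈-insert⁻ b _ h
  ... | inj₁ a≡b = a≢b a≡b
  ... | inj₂ a∈c = a≢c (x∈⁅y⁆⇒x≡y c a∈c)

record Enumeration {n} (S : Subset n) (k : ℕ) : Set where
  field
    element   : Fin k → Fin n
    injective : Injective _≡_ _≡_ element
    member    : ∀ i → element i ∈ S
    covers    : ∀ u → u ∈ S → ∃ λ i → element i ≡ u

open Enumeration

extend-inside : ∀ {n k} {S : Subset n} → Enumeration S k → Enumeration (inside ∷ S) (suc k)
extend-inside {S = S} E = record
  { element = element′ ; injective = injective′ ; member = member′ ; covers = covers′ }
  where
  element′ : Fin (suc _) → Fin (suc _)
  element′ zero    = zero
  element′ (suc i) = suc (element E i)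
  injective′ : Injective _≡_ _≡_ element′
  injective′ {zero}  {zero}  _  = refl
  injective′ {suc i} {suc j} eq = cong suc (injective E (suc-injective eq))
  injective′ {zero}  {suc j} ()
  injective′ {suc i} {zero}  ()
  member′ : ∀ i → element′ i ∈ (inside ∷ S)
  member′ zero    = here
  member′ (suc i) = there (member E i)
  covers′ : ∀ u → u ∈ (inside ∷ S) → ∃ λ i → element′ i ≡ u
  covers′ zero    _         = zero , refl
  covers′ (suc u) (there h) with covers E u h
  ... | i , eᵢ≡u = suc i , cong suc eᵢ≡u

extend-outside : ∀ {n k} {S : Subset n} → Enumeration S k → Enumeration (outside ∷ S) k
extend-outside {S = S} E = record
  { element = λ i → suc (element E i)
  ; injective = λ eq → injective E (suc-injective eq)
  ; member = λ i → there (member E i)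
  ; covers = covers′
  }
  where
  covers′ : ∀ u → u ∈ (outside ∷ S) → ∃ λ i → suc (element E i) ≡ u
  covers′ (suc u) (there h) with covers E u h
  ... | i , eᵢ≡u = i , cong suc eᵢ≡u

enumerate : ∀ {n} (S : Subset n) → Enumeration S ∣ S ∣
enumerate []            = record
  { element = λ () ; injective = λ { {()} } ; member = λ () ; covers = λ () }
enumerate (inside ∷ S)  = extend-inside (enumerate S)
enumerate (outside ∷ S) = extend-outside (enumerate S)

module _ (G : Graph) where
  open Graph G using (n; adj; irref) renaming (sym to adj-sym)

  walk-length-0 : ∀ {x y} → Walk G x y 0 → x ≡ y
  walk-length-0 here = refl

  walk-length-1 : ∀ {x y} → Walk G x y 1 → adj x y ≡ true
  walk-length-1 (step x~y here) = x~y

  dist-unique : ∀ {x y k k′} → Dist G x y k → Dist G x y k′ → k ≡ k′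
  dist-unique (walk , shortest) (walk′ , shortest′) =
    ≤-antisym (shortest _ walk′) (shortest′ _ walk)

  adjacent⇒dist-1 : ∀ {x y} → adj x y ≡ true → Dist G x y 1
  adjacent⇒dist-1 {x} {y} x~y = step x~y here , shortest
    where
    shortest : ∀ m → Walk G x y m → 1 ≤ m
    shortest zero    walk with refl ← walk-length-0 walk with () ← trans (sym x~y) (irref x)
    shortest (suc m) _    = s≤s z≤n

  common-neighbour⇒dist-2 : ∀ {x m y} → x ≢ y → adj x y ≡ false →
    adj x m ≡ true → adj m y ≡ true → Dist G x y 2
  common-neighbour⇒dist-2 {x} {y = y} x≢y x≁y x~m m~y = step x~m (step m~y here) , shortest
    where
    shortest : ∀ k → Walk G x y k → 2 ≤ k
    shortest zero          walk = ⊥-elim (x≢y (walk-length-0 walk))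
    shortest (suc zero)    walk with () ← trans (sym (walk-length-1 walk)) x≁y
    shortest (suc (suc k)) _    = s≤s (s≤s z≤n)

  ∈N⇒adj : ∀ {v u} → u ∈ N G v → adj v u ≡ true
  ∈N⇒adj {v} {u} u∈N = trans (sym (lookup∘tabulate (adj v) u)) ([]=⇒lookup u∈N)

  ∈N⇒adj′ : ∀ {v u} → u ∈ N G v → adj u v ≡ true
  ∈N⇒adj′ {v} {u} u∈N = trans (adj-sym u v) (∈N⇒adj u∈N)

  ∉N-self : ∀ {v u} → u ∈ N G v → v ≢ u
  ∉N-self {v} u∈N refl with () ← trans (sym (∈N⇒adj u∈N)) (irref v)

  neighbours-dist : ∀ {v x y} → x ≢ y → x ∈ N G v → y ∈ N G v →
    Dist G x y (if adj x y then 1 else 2)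
  neighbours-dist {x = x} {y} x≢y x∈N y∈N with adj x y in x~y
  ... | true  = adjacent⇒dist-1 x~y
  ... | false = common-neighbour⇒dist-2 x≢y x~y (∈N⇒adj′ x∈N) (∈N⇒adj y∈N)

  Equidistant : Fin n → Fin n → Fin n → Set
  Equidistant x y w = ∀ {k k′} → Dist G x w k → Dist G y w k′ → k ≡ k′

  equidistant⇒¬resolving : ∀ {W x y} → x ≢ y → (∀ w → w ∈ W → Equidistant x y w) →
    ¬ Resolving G W
  equidistant⇒¬resolving {x = x} {y} x≢y equidistant resolves
    with w , w∈W , k , k′ , dₓ , dᵧ , k≢k′ ← resolves x y x≢y = k≢k′ (equidistant w w∈W dₓ dᵧ)

  centre-equidistant : ∀ {v x y} → x ∈ N G v → y ∈ N G v → Equidistant x y v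
  centre-equidistant x∈N y∈N dₓ dᵧ =
    trans (dist-unique dₓ (adjacent⇒dist-1 (∈N⇒adj′ x∈N)))
          (dist-unique (adjacent⇒dist-1 (∈N⇒adj′ y∈N)) dᵧ)

  neighbour-equidistant : ∀ {v x y a} → x ∈ N G v → y ∈ N G v → a ∈ N G v →
    x ≢ a → y ≢ a → adj x a ≡ adj y a → Equidistant x y a
  neighbour-equidistant x∈N y∈N a∈N x≢a y≢a x~a≡y~a dₓ dᵧ =
    trans (dist-unique dₓ (neighbours-dist x≢a x∈N a∈N))
          (trans (cong (λ b → if b then 1 else 2) x~a≡y~a)
                 (dist-unique (neighbours-dist y≢a y∈N a∈N) dᵧ))

  -- If every 3-set resolves G, then two distinct neighbours x, y of v are
  -- separated by one of any two further neighbours a, b: otherwise the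
  -- 3-set {v, a, b} would not resolve x and y.
  neighbours-separated : AllResolving G 3 → ∀ {v x y a b} →
    x ∈ N G v → y ∈ N G v → a ∈ N G v → b ∈ N G v →
    x ≢ y → a ≢ b → a ≢ x → a ≢ y → b ≢ x → b ≢ y →
    adj x a ≡ adj y a → adj x b ≢ adj y b
  neighbours-separated all3 {v} {x} {y} {a} {b} x∈N y∈N a∈N b∈N
                       x≢y a≢b a≢x a≢y b≢x b≢y x~a≡y~a x~b≡y~b =
    equidistant⇒¬resolving x≢y equidistant
      (all3 (triple v a b) (∣triple∣ (∉N-self a∈N) (∉N-self b∈N) a≢b))
    where
    equidistant : ∀ w → w ∈ triple v a b → Equidistant x y w
    equidistant w w∈W with ∈-triple⁻ w∈W
    ... | inj₁ refl        = centre-equidistant x∈N y∈N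
    ... | inj₂ (inj₁ refl) =
      neighbour-equidistant x∈N y∈N a∈N (≢-sym a≢x) (≢-sym a≢y) x~a≡y~a
    ... | inj₂ (inj₂ refl) =
      neighbour-equidistant x∈N y∈N b∈N (≢-sym b≢x) (≢-sym b≢y) x~b≡y~b

  induced : ∀ {S : Subset n} → Enumeration S 5 → Graph₅
  induced E i j = adj (element E i) (element E j)

  induced-symmetric : ∀ {S : Subset n} (E : Enumeration S 5) → ∀ i j → induced E i j ≡ induced E j i
  induced-symmetric E i j = adj-sym (element E i) (element E j)

  induced-irreflexive : ∀ {S : Subset n} (E : Enumeration S 5) → ∀ i → induced E i i ≡ false
  induced-irreflexive E i = irref (element E i)

  neighbourhood-separating : AllResolving G 3 → ∀ {v} (E : Enumeration (N G v) 5) →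
    Separating (induced E)
  neighbourhood-separating all3 E i j k l i≢j k≢l k≢i k≢j l≢i l≢j =
    neighbours-separated all3 (member E i) (member E j) (member E k) (member E l)
      (distinct i≢j) (distinct k≢l) (distinct k≢i) (distinct k≢j) (distinct l≢i) (distinct l≢j)
    where
    distinct : ∀ {i j} → i ≢ j → element E i ≢ element E j
    distinct i≢j eq = i≢j (injective E eq)

  labelling⇒InducedIsC5 : ∀ {S} (E : Enumeration S 5) {σ} → C5Labelling (induced E) σ →
    InducedIsC5 G S
  labelling⇒InducedIsC5 {S} E {σ} (σ-inj , σ-surj , σ-iso) =
    (λ a → element E (σ a)) , (λ eq → σ-inj (injective E eq)) , (λ a → member E (σ a)) ,
    covers′ , σ-iso
    where
    covers′ : ∀ u → u ∈ S → ∃ λ a → element E (σ a) ≡ u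
    covers′ u u∈S with i , eᵢ≡u ← covers E u u∈S with a , σa≡i ← σ-surj i =
      a , trans (cong (element E) σa≡i) eᵢ≡u

mainTheorem12 : (G : Graph) → Connected G → ResNumber G 3 →
    (v : Fin (Graph.n G)) → degree G v ≡ 5 → InducedIsC5 G (N G v)
mainTheorem12 G _ (all3 , _) v deg≡5 =
  labelling⇒InducedIsC5 G E (proj₂ (separating⇒C5 (induced G E)
    (induced-symmetric G E) (induced-irreflexive G E) (neighbourhood-separating G all3 E)))
  where
  E : Enumeration (N G v) 5
  E = subst (Enumeration (N G v)) deg≡5 (enumerate (N G v))
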